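{- Let $G^+=(V,E^+)$ be a finite simple undirected graph, $\phi\ge0$, $0\le\eta<1$, and let $\mathcal{C}^*$ be a clustering with $\mathrm{obj}(\mathcal{C}^*)\le\phi$. Consider any execution of Algorithm ClusterPhi$(G^+,\phi,\eta)$. For each $i$, let $C^*_i$ be the cluster of $\mathcal{C}^*$ such that $L_i\cap V_{\mathrm{high}}=C^*_i\cap V_{\mathrm{high}}$. Then for every $i$, $|N[u_i]\Delta C_i|\le\phi$ and $|C^*_i\Delta C_i|\le\phi$.
   Context: For $u\in V$, $N(u)$ is the set of neighbours of $u$ in $G^+$, $\deg(u)=|N(u)|$, and $N[u]=N(u)\cup\{u\}$. $\Delta$ denotes symmetric difference. A clustering $\mathcal{C}$ is a partition of $V$, and $\mathcal{C}_u$ denotes the cluster containing $u$. The disagreement of $u$ is $\rho_{\mathcal{C}}(u)=|N[u]\Delta\mathcal{C}_u|$, and $\mathrm{obj}(\mathcal{C})=\max_u\rho_{\mathcal{C}}(u)$. An $\eta'$-similarity query $\Delta_{\eta'}(u,v,t)$ returns: - $0$ if $|N[u]\Delta N[v]|>(1+\eta')t$; - $1$ if $|N[u]\Delta N[v]|\le t$; - arbitrarily $0$ or $1$ otherwise. Algorithm ClusterPhi$(G^+,\phi,\eta)$, main loop: 1. Let $E'$ be the set of pairs $\{u,v\}$ for which $\Delta_\eta(u,v,2\phi)$ returns $1$. 2. Let $V_{\mathrm{low}}=\{w:\deg(w)\le(3+\eta)\phi\}$ and $V_{\mathrm{high}}=V\setminus V_{\mathrm{low}}$. Set $V_1=V_{\mathrm{low}}$.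 3. Let $L_1,\dots,L_k$ be the connected components of $(V_{\mathrm{high}},E')$, in any order. 4. For $i=1,\dots,k$: - choose any $u_i\in L_i$; - let $R(u_i)=\{w\in V_i\cap N(u_i):\Delta_{\eta/2}(w,u_i,2\phi)\text{ returns }1\}$; - set $C_i=L_i\cup R(u_i)$ and $V_{i+1}=V_i\setminus R(u_i)$.
   Formalization: The parameters φ and η are taken to be rational numbers. -}

module Defs where

open import Data.Bool using (Bool; true; false; _∧_)
open import Data.Nat using (ℕ; suc)
open import Data.Integer using (+_)
open import Data.Fin using (Fin; zero; suc; inject₁)
open import Data.Fin.Subset using (Subset; _∪_; _∩_; _─_; ⁅_⁆; ∣_∣; _∈_)
open import Data.Vec using (tabulate)
open import Data.Rational using (ℚ; _/_; _+_; _*_; _≤_; _<_; 1ℚ; ½)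
open import Data.Rational.Properties using (_≤?_)
import Data.Nat as ℕ
open import Data.Product using (Σ; _×_)
open import Function.Bundles using (_⇔_)
open import Relation.Nullary using (does)
open import Relation.Binary.PropositionalEquality using (_≡_)

toℚ : ℕ → ℚ
toℚ m = + m / 1

_Δ_ : ∀ {n} → Subset n → Subset n → Subset n
A Δ B = (A ─ B) ∪ (B ─ A)

record SimpleGraph (n : ℕ) : Set where
  field
    adj       : Fin n → Fin n → Bool
    symmetric : ∀ u v → adj u v ≡ adj v u
    irreflex  : ∀ u → adj u u ≡ false

module _ {n : ℕ} (G : SimpleGraph n) where
  open SimpleGraph G

  Nbr : Fin n → Subset n
  Nbr u = tabulate (adj u)

  CNbr : Fin n → Subset n
  CNbr u = Nbr u ∪ ⁅ u ⁆

  deg : Fin n → ℕ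
  deg u = ∣ Nbr u ∣

  nbrDist : Fin n → Fin n → ℕ
  nbrDist u v = ∣ CNbr u Δ CNbr v ∣

  -- b is a legal answer of the η'-similarity query Δ_η'(u,v,t)
  ValidAnswer : ℚ → ℚ → Fin n → Fin n → Bool → Set
  ValidAnswer η' t u v b =
    ((1ℚ + η') * t < toℚ (nbrDist u v) → b ≡ false)
    × (toℚ (nbrDist u v) ≤ t → b ≡ true)

-- A clustering (partition of Fin n) given by a cluster label per vertex;
-- the cluster of u is the set of vertices with the same label.
Clustering : ℕ → Set
Clustering n = Fin n → ℕ

cluster : ∀ {n} → Clustering n → Fin n → Subset n
cluster c u = tabulate (λ v → does (c v ℕ.≟ c u))

disagreement : ∀ {n} → SimpleGraph n → Clustering n → Fin n → ℕ
disagreement G c u = ∣ CNbr G u Δ cluster c u ∣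

ObjAtMost : ∀ {n} → SimpleGraph n → Clustering n → ℚ → Set
ObjAtMost G c φ = ∀ u → toℚ (disagreement G c u) ≤ φ

-- The run of ClusterPhi, parametrised by the nondeterministic choices.
module ClusterPhi {n : ℕ} (G : SimpleGraph n) (φ η : ℚ)
                  -- answers to the queries Δ_η(u,v,2φ) defining E'
                  (e : Fin n → Fin n → Bool)
                  -- answers to the queries Δ_{η/2}(w,u,2φ)
                  (r : Fin n → Fin n → Bool) where
  open SimpleGraph G

  Vlow : Subset n
  Vlow = tabulate (λ w → does (toℚ (deg G w) ≤? ((toℚ 3 + η) * φ)))

  Vhigh : Subset n
  Vhigh = tabulate (λ w → Data.Bool.not (does (toℚ (deg G w) ≤? ((toℚ 3 + η) * φ))))
    where import Data.Bool

  data Reach : Fin n → Fin n → Set where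
    here : ∀ {v} → v ∈ Vhigh → Reach v v
    step : ∀ {v w x} → Reach v w → x ∈ Vhigh → e w x ≡ true → Reach v x

  IsComponent : Subset n → Set
  IsComponent L = Σ (Fin n) λ v → v ∈ Vhigh × (∀ w → (w ∈ L ⇔ Reach v w))

  IsComponentEnumeration : (k : ℕ) → (Fin k → Subset n) → Set
  IsComponentEnumeration k L =
    (∀ i → IsComponent (L i))
    × (∀ L' → IsComponent L' → Σ (Fin k) λ i → L i ≡ L')
    × (∀ i j → L i ≡ L j → i ≡ j)

  Rset : Subset n → Fin n → Subset n
  Rset V u = tabulate (λ w → r w u) ∩ (V ∩ Nbr G u)

  -- V_i (0-indexed: Vstage u i is V_{i+1} of the paper), given the chosen
  -- centres u_0,…,u_{k-1}
  Vstage : ∀ {k} → (Fin k → Fin n) → Fin k → Subset n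
  Vstage {suc k} u zero    = Vlow
  Vstage {suc k} u (suc i) =
    let V' = Vstage (λ j → u (inject₁ j)) i
    in V' ─ Rset V' (u (inject₁ i))

  R : ∀ {k} → (Fin k → Fin n) → Fin k → Subset n
  R u i = Rset (Vstage u i) (u i)

  Cout : ∀ {k} → (Fin k → Subset n) → (Fin k → Fin n) → Fin k → Subset n
  Cout L u i = L i ∪ R u i

{-# OPTIONS --safe #-}
module Submission where

-- Write ρ(x) = |N[x] Δ C*ₓ| ≤ φ. Since |· Δ ·| satisfies the triangle inequality,
-- |N[x] Δ N[y]| ≤ ρ(x) + ρ(y) ≤ 2φ inside a cluster of C*, so such pairs pass both
-- similarity queries. Conversely deg(a) ≤ |C*ₐ| + ρ(a), and two distinct clusters are
-- disjoint, so if a, b are high vertices of distinct clusters and x ∈ C*ₐ then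
-- |N[x] Δ N[b]| ≥ deg(a) + deg(b) − 4φ > 2(3+η)φ − 4φ = (1+η)·2φ and both queries reject.
-- Hence each Lᵢ is the high part of the cluster C*ᵢ of uᵢ, no centre of another cluster
-- takes a low vertex of C*ᵢ, and N[uᵢ] ∩ C*ᵢ ⊆ Cᵢ ⊆ N[uᵢ] ∪ C*ᵢ. For any such Cᵢ both
-- N[uᵢ] Δ Cᵢ and C*ᵢ Δ Cᵢ are contained in N[uᵢ] Δ C*ᵢ, of size ρ(uᵢ) ≤ φ.

open import Defs
open import Data.Bool using (Bool; true; false; not)
open import Data.Nat as ℕ using (ℕ; suc; _+_)
import Data.Nat.Properties as ℕ
open import Data.Fin as Fin using (Fin; zero; suc)
import Data.Fin.Properties as Finₚ
open import Data.Fin.Subset using (Subset; _∪_; _∩_; _─_; _∈_; _∉_; _⊆_; ∣_∣; ⊥; ⁅_⁆)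
open import Data.Fin.Subset.Properties
open import Data.Vec using ([]; _∷_; here; there; tabulate)
open import Data.Vec.Properties using (lookup∘tabulate; []=⇒lookup; lookup⇒[]=)
open import Data.Integer as ℤ using (+_)
import Data.Integer.Properties as ℤ
open import Data.Rational as ℚ using (ℚ; mkℚ; 0ℚ; 1ℚ; ½; _≤_; _<_; _*_)
import Data.Rational.Properties as ℚ
import Data.Nat.Coprimality as Coprime
open import Data.Rational.Solver using (module +-*-Solver)
open +-*-Solver using (solve; _:+_; _:*_; _:=_; con)
open import Data.Product using (_×_; _,_; proj₁; proj₂)
open import Data.Sum using (_⊎_; inj₁; inj₂)
open import Function using (_∘_)
open import Relation.Nullary using (Dec; yes; no; does; ¬_; contradiction)
open import Relation.Nullary.Decidable using (dec-true; decidable-stable)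
open import Relation.Binary.PropositionalEquality
open import Function.Bundles using (Equivalence; _⇔_; mk⇔)
open import Data.Bool.Properties using (T-≡)
open import Algebra.Properties.CommutativeSemigroup ℕ.+-commutativeSemigroup using (interchange; x∙yz≈y∙xz)

private variable
  n : ℕ

∈-tabulate⁺ : ∀ (f : Fin n → Bool) {x} → f x ≡ true → x ∈ tabulate f
∈-tabulate⁺ f {x} fx = lookup⇒[]= x (tabulate f) (trans (lookup∘tabulate f x) fx)

∈-tabulate⁻ : ∀ (f : Fin n → Bool) {x} → x ∈ tabulate f → f x ≡ true
∈-tabulate⁻ f {x} x∈ = trans (sym (lookup∘tabulate f x)) ([]=⇒lookup x∈)

∉-tabulate-not : ∀ (f : Fin n → Bool) {x} → x ∉ tabulate (not ∘ f) → x ∈ tabulate f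
∉-tabulate-not f {x} x∉ with f x in fx
... | true  = ∈-tabulate⁺ f fx
... | false = contradiction (∈-tabulate⁺ (not ∘ f) (cong not fx)) x∉

¬-from-not-does : ∀ {P : Set} (P? : Dec P) → not (does P?) ≡ true → ¬ P
¬-from-not-does (yes _)  ()
¬-from-not-does (no ¬p) _ = ¬p

∣p∪q∣+∣p∩q∣≡∣p∣+∣q∣ : ∀ (p q : Subset n) → ∣ p ∪ q ∣ + ∣ p ∩ q ∣ ≡ ∣ p ∣ + ∣ q ∣
∣p∪q∣+∣p∩q∣≡∣p∣+∣q∣ []           []           = refl
∣p∪q∣+∣p∩q∣≡∣p∣+∣q∣ (true  ∷ p) (true  ∷ q) =
  cong suc (trans (ℕ.+-suc _ _) (trans (cong suc (∣p∪q∣+∣p∩q∣≡∣p∣+∣q∣ p q)) (sym (ℕ.+-suc _ _))))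
∣p∪q∣+∣p∩q∣≡∣p∣+∣q∣ (true  ∷ p) (false ∷ q) = cong suc (∣p∪q∣+∣p∩q∣≡∣p∣+∣q∣ p q)
∣p∪q∣+∣p∩q∣≡∣p∣+∣q∣ (false ∷ p) (true  ∷ q) =
  trans (cong suc (∣p∪q∣+∣p∩q∣≡∣p∣+∣q∣ p q)) (sym (ℕ.+-suc _ _))
∣p∪q∣+∣p∩q∣≡∣p∣+∣q∣ (false ∷ p) (false ∷ q) = ∣p∪q∣+∣p∩q∣≡∣p∣+∣q∣ p q

∣p∪q∣≤∣p∣+∣q∣ : ∀ (p q : Subset n) → ∣ p ∪ q ∣ ℕ.≤ ∣ p ∣ + ∣ q ∣
∣p∪q∣≤∣p∣+∣q∣ p q = ℕ.≤-trans (ℕ.m≤m+n _ _) (ℕ.≤-reflexive (∣p∪q∣+∣p∩q∣≡∣p∣+∣q∣ p q))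

x∈p─q⇒x∉q : ∀ (p q : Subset n) {x} → x ∈ p ─ q → x ∉ q
x∈p─q⇒x∉q (true ∷ p) (false ∷ q) here      ()
x∈p─q⇒x∉q (_    ∷ p) (_     ∷ q) (there x∈) (there x∈q) = x∈p─q⇒x∉q p q x∈ x∈q

module _ {p q : Subset n} {x : Fin n} where

  x∈pΔq⁺ˡ : x ∈ p → x ∉ q → x ∈ p Δ q
  x∈pΔq⁺ˡ x∈p x∉q = x∈p∪q⁺ (inj₁ (x∈p∧x∉q⇒x∈p─q x∈p x∉q))

  x∈pΔq⁺ʳ : x ∈ q → x ∉ p → x ∈ p Δ q
  x∈pΔq⁺ʳ x∈q x∉p = x∈p∪q⁺ (inj₂ (x∈p∧x∉q⇒x∈p─q x∈q x∉p))

  x∈pΔq⁻ : x ∈ p Δ q → (x ∈ p × x ∉ q) ⊎ (x ∈ q × x ∉ p)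
  x∈pΔq⁻ x∈ with x∈p∪q⁻ (p ─ q) (q ─ p) x∈
  ... | inj₁ x∈p─q = inj₁ (p─q⊆p p q x∈p─q , x∈p─q⇒x∉q p q x∈p─q)
  ... | inj₂ x∈q─p = inj₂ (p─q⊆p q p x∈q─p , x∈p─q⇒x∉q q p x∈q─p)

Δ-comm : ∀ (p q : Subset n) → p Δ q ≡ q Δ p
Δ-comm p q = ∪-comm (p ─ q) (q ─ p)

pΔq⊆pΔr∪rΔq : ∀ (p q r : Subset n) → p Δ q ⊆ (p Δ r) ∪ (r Δ q)
pΔq⊆pΔr∪rΔq p q r {x} x∈ with x∈pΔq⁻ x∈ | x ∈? r
... | inj₁ (x∈p , x∉q) | yes x∈r = x∈p∪q⁺ (inj₂ (x∈pΔq⁺ˡ x∈r x∉q))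
... | inj₁ (x∈p , x∉q) | no  x∉r = x∈p∪q⁺ (inj₁ (x∈pΔq⁺ˡ x∈p x∉r))
... | inj₂ (x∈q , x∉p) | yes x∈r = x∈p∪q⁺ (inj₁ (x∈pΔq⁺ʳ x∈r x∉p))
... | inj₂ (x∈q , x∉p) | no  x∉r = x∈p∪q⁺ (inj₂ (x∈pΔq⁺ʳ x∈q x∉r))

∣pΔq∣≤∣pΔr∣+∣rΔq∣ : ∀ (p q r : Subset n) → ∣ p Δ q ∣ ℕ.≤ ∣ p Δ r ∣ + ∣ r Δ q ∣
∣pΔq∣≤∣pΔr∣+∣rΔq∣ p q r =
  ℕ.≤-trans (p⊆q⇒∣p∣≤∣q∣ (pΔq⊆pΔr∪rΔq p q r)) (∣p∪q∣≤∣p∣+∣q∣ (p Δ r) (r Δ q))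

∣p∣≤∣q∣+∣pΔq∣ : ∀ (p q : Subset n) → ∣ p ∣ ℕ.≤ ∣ q ∣ + ∣ p Δ q ∣
∣p∣≤∣q∣+∣pΔq∣ p q = ℕ.≤-trans (p⊆q⇒∣p∣≤∣q∣ p⊆q∪pΔq) (∣p∪q∣≤∣p∣+∣q∣ q (p Δ q))
  where
  p⊆q∪pΔq : p ⊆ q ∪ (p Δ q)
  p⊆q∪pΔq {x} x∈p with x ∈? q
  ... | yes x∈q = x∈p∪q⁺ (inj₁ x∈q)
  ... | no  x∉q = x∈p∪q⁺ (inj₂ (x∈pΔq⁺ˡ x∈p x∉q))

∣p∣+∣q∣≤∣pΔq∣ : ∀ {n} (p q : Subset n) → (∀ {x} → x ∈ p → x ∉ q) → ∣ p ∣ + ∣ q ∣ ℕ.≤ ∣ p Δ q ∣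
∣p∣+∣q∣≤∣pΔq∣ {n} p q disjoint = begin
  ∣ p ∣ + ∣ q ∣             ≡⟨ ∣p∪q∣+∣p∩q∣≡∣p∣+∣q∣ p q ⟨
  ∣ p ∪ q ∣ + ∣ p ∩ q ∣     ≤⟨ ℕ.+-monoʳ-≤ ∣ p ∪ q ∣ ∣p∩q∣≤0 ⟩
  ∣ p ∪ q ∣ + 0             ≡⟨ ℕ.+-identityʳ _ ⟩
  ∣ p ∪ q ∣                 ≤⟨ p⊆q⇒∣p∣≤∣q∣ p∪q⊆pΔq ⟩
  ∣ p Δ q ∣                 ∎
  where
  open ℕ.≤-Reasoning
  ∣p∩q∣≤0 : ∣ p ∩ q ∣ ℕ.≤ 0
  ∣p∩q∣≤0 = ℕ.≤-trans (p⊆q⇒∣p∣≤∣q∣ p∩q⊆⊥) (ℕ.≤-reflexive (∣⊥∣≡0 n))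
    where
    p∩q⊆⊥ : p ∩ q ⊆ ⊥
    p∩q⊆⊥ x∈ with x∈p , x∈q ← x∈p∩q⁻ p q x∈ = contradiction x∈q (disjoint x∈p)
  p∪q⊆pΔq : p ∪ q ⊆ p Δ q
  p∪q⊆pΔq x∈ with x∈p∪q⁻ p q x∈
  ... | inj₁ x∈p = x∈pΔq⁺ˡ x∈p (disjoint x∈p)
  ... | inj₂ x∈q = x∈pΔq⁺ʳ x∈q (λ x∈p → disjoint x∈p x∈q)

module _ {p q s : Subset n} (p∩q⊆s : p ∩ q ⊆ s) (s⊆p∪q : s ⊆ p ∪ q) where

  pΔs⊆pΔq : p Δ s ⊆ p Δ q
  pΔs⊆pΔq x∈ with x∈pΔq⁻ x∈
  ... | inj₁ (x∈p , x∉s) = x∈pΔq⁺ˡ x∈p (λ x∈q → x∉s (p∩q⊆s (x∈p∩q⁺ (x∈p , x∈q))))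
  ... | inj₂ (x∈s , x∉p) with x∈p∪q⁻ p q (s⊆p∪q x∈s)
  ...   | inj₁ x∈p = contradiction x∈p x∉p
  ...   | inj₂ x∈q = x∈pΔq⁺ʳ x∈q x∉p

  qΔs⊆pΔq : q Δ s ⊆ p Δ q
  qΔs⊆pΔq x∈ with x∈pΔq⁻ x∈
  ... | inj₁ (x∈q , x∉s) = x∈pΔq⁺ʳ x∈q (λ x∈p → x∉s (p∩q⊆s (x∈p∩q⁺ (x∈p , x∈q))))
  ... | inj₂ (x∈s , x∉q) with x∈p∪q⁻ p q (s⊆p∪q x∈s)
  ...   | inj₁ x∈p = x∈pΔq⁺ˡ x∈p x∉q
  ...   | inj₂ x∈q = contradiction x∈q x∉q

module _ (c : Clustering n) {x y : Fin n} where

  ∈cluster⁺ : c y ≡ c x → y ∈ cluster c x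
  ∈cluster⁺ eq = ∈-tabulate⁺ _ (dec-true (c y ℕ.≟ c x) eq)

  ∈cluster⁻ : y ∈ cluster c x → c y ≡ c x
  ∈cluster⁻ y∈ = ℕ.≡ᵇ⇒≡ (c y) (c x) (Equivalence.from T-≡ (∈-tabulate⁻ _ y∈))

  cluster-cong : c x ≡ c y → cluster c x ≡ cluster c y
  cluster-cong eq = cong (λ k → tabulate (λ v → does (c v ℕ.≟ k))) eq

module _ (G : SimpleGraph n) (c : Clustering n) where

  private
    N C : Fin n → Subset n
    N = CNbr G
    C = cluster c
    ρ : Fin n → ℕ
    ρ = disagreement G c

  nbrDist≤disagreement+disagreement : ∀ {x y} → c x ≡ c y → nbrDist G x y ℕ.≤ ρ x + ρ y
  nbrDist≤disagreement+disagreement {x} {y} eq = begin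
    ∣ N x Δ N y ∣             ≤⟨ ∣pΔq∣≤∣pΔr∣+∣rΔq∣ (N x) (N y) (C x) ⟩
    ρ x + ∣ C x Δ N y ∣       ≡⟨ cong (λ D → ρ x + ∣ D Δ N y ∣) (cluster-cong c eq) ⟩
    ρ x + ∣ C y Δ N y ∣       ≡⟨ cong (λ D → ρ x + ∣ D ∣) (Δ-comm (C y) (N y)) ⟩
    ρ x + ρ y                 ∎
    where open ℕ.≤-Reasoning

  deg≤∣cluster∣+disagreement : ∀ x → deg G x ℕ.≤ ∣ C x ∣ + ρ x
  deg≤∣cluster∣+disagreement x =
    ℕ.≤-trans (p⊆q⇒∣p∣≤∣q∣ (p⊆p∪q {p = Nbr G x} ⁅ x ⁆)) (∣p∣≤∣q∣+∣pΔq∣ (N x) (C x))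

  ∣cluster∣+∣cluster∣≤ : ∀ {x y} → c x ≢ c y → ∣ C x ∣ + ∣ C y ∣ ℕ.≤ nbrDist G x y + (ρ x + ρ y)
  ∣cluster∣+∣cluster∣≤ {x} {y} ne = begin
    ∣ C x ∣ + ∣ C y ∣                         ≤⟨ ∣p∣+∣q∣≤∣pΔq∣ (C x) (C y) disjoint ⟩
    ∣ C x Δ C y ∣                             ≤⟨ ∣pΔq∣≤∣pΔr∣+∣rΔq∣ (C x) (C y) (N x) ⟩
    ∣ C x Δ N x ∣ + ∣ N x Δ C y ∣             ≤⟨ ℕ.+-monoʳ-≤ ∣ C x Δ N x ∣ (∣pΔq∣≤∣pΔr∣+∣rΔq∣ (N x) (C y) (N y)) ⟩
    ∣ C x Δ N x ∣ + (nbrDist G x y + ∣ N y Δ C y ∣) ≡⟨ cong (λ D → ∣ D ∣ + (nbrDist G x y + ρ y)) (Δ-comm (C x) (N x)) ⟩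
    ρ x + (nbrDist G x y + ρ y)               ≡⟨ x∙yz≈y∙xz (ρ x) (nbrDist G x y) (ρ y) ⟩
    nbrDist G x y + (ρ x + ρ y)               ∎
    where
    open ℕ.≤-Reasoning
    disjoint : ∀ {z} → z ∈ C x → z ∉ C y
    disjoint z∈Cx z∈Cy = ne (trans (sym (∈cluster⁻ c z∈Cx)) (∈cluster⁻ c z∈Cy))

  deg+deg≤nbrDist+disagreements : ∀ {x a b} → c x ≡ c a → c a ≢ c b →
    deg G a + deg G b ℕ.≤ nbrDist G x b + ((ρ x + ρ b) + (ρ a + ρ b))
  deg+deg≤nbrDist+disagreements {x} {a} {b} x~a a≁b = begin
    deg G a + deg G b                           ≤⟨ ℕ.+-mono-≤ (deg≤∣cluster∣+disagreement a) (deg≤∣cluster∣+disagreement b) ⟩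
    (∣ C a ∣ + ρ a) + (∣ C b ∣ + ρ b)           ≡⟨ interchange (∣ C a ∣) (ρ a) (∣ C b ∣) (ρ b) ⟩
    (∣ C a ∣ + ∣ C b ∣) + (ρ a + ρ b)           ≡⟨ cong (λ D → (∣ D ∣ + ∣ C b ∣) + (ρ a + ρ b)) (cluster-cong c (sym x~a)) ⟩
    (∣ C x ∣ + ∣ C b ∣) + (ρ a + ρ b)           ≤⟨ ℕ.+-monoˡ-≤ (ρ a + ρ b) (∣cluster∣+∣cluster∣≤ (a≁b ∘ trans (sym x~a))) ⟩
    (nbrDist G x b + (ρ x + ρ b)) + (ρ a + ρ b) ≡⟨ ℕ.+-assoc (nbrDist G x b) (ρ x + ρ b) (ρ a + ρ b) ⟩
    nbrDist G x b + ((ρ x + ρ b) + (ρ a + ρ b)) ∎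
    where open ℕ.≤-Reasoning

toℚ≡mkℚ : ∀ m → toℚ m ≡ mkℚ (+ m) 0 (Coprime.sym (Coprime.1-coprimeTo m))
toℚ≡mkℚ m = ℚ.normalize-coprime (Coprime.sym (Coprime.1-coprimeTo m))

toℚ-homo-+ : ∀ a b → toℚ (a + b) ≡ toℚ a ℚ.+ toℚ b
toℚ-homo-+ a b = begin
  toℚ (a + b)                                 ≡⟨ ℚ./-cong {p₁ = + (a + b)} {q₁ = 1} (sym +a*1++b*1≡+[a+b]) refl ⟩
  (+ a ℤ.* + 1 ℤ.+ + b ℤ.* + 1) ℚ./ (1 ℕ.* 1) ≡⟨ cong₂ ℚ._+_ (toℚ≡mkℚ a) (toℚ≡mkℚ b) ⟨
  toℚ a ℚ.+ toℚ b                             ∎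
  where
  open ≡-Reasoning
  +a*1++b*1≡+[a+b] : + a ℤ.* + 1 ℤ.+ + b ℤ.* + 1 ≡ + (a + b)
  +a*1++b*1≡+[a+b] = cong₂ ℤ._+_ (ℤ.*-identityʳ (+ a)) (ℤ.*-identityʳ (+ b))

toℚ-mono-≤ : ∀ {a b} → a ℕ.≤ b → toℚ a ≤ toℚ b
toℚ-mono-≤ {a} {b} a≤b rewrite toℚ≡mkℚ a | toℚ≡mkℚ b =
  ℚ.*≤* (subst₂ ℤ._≤_ (sym (ℤ.*-identityʳ (+ a))) (sym (ℤ.*-identityʳ (+ b))) (ℤ.+≤+ a≤b))

toℚ-+-≤ : ∀ a b {p q} → toℚ a ≤ p → toℚ b ≤ q → toℚ (a + b) ≤ p ℚ.+ q
toℚ-+-≤ a b a≤p b≤q = subst (_≤ _) (sym (toℚ-homo-+ a b)) (ℚ.+-mono-≤ a≤p b≤q)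

p+p≡2*p : ∀ p → p ℚ.+ p ≡ toℚ 2 * p
p+p≡2*p = solve 1 (λ p → p :+ p := con (toℚ 2) :* p) refl

+-cancelʳ-< : ∀ p q r → p ℚ.+ r < q ℚ.+ r → p < q
+-cancelʳ-< p q r p+r<q+r = subst₂ _<_ (p+r-r≡p p) (p+r-r≡p q) (ℚ.+-monoˡ-< (ℚ.- r) p+r<q+r)
  where
  p+r-r≡p : ∀ p → p ℚ.+ r ℚ.- r ≡ p
  p+r-r≡p p = trans (ℚ.+-assoc p r (ℚ.- r)) (trans (cong (p ℚ.+_) (ℚ.+-inverseʳ r)) (ℚ.+-identityʳ p))

[1+η]*[2*φ]<d : ∀ φ η {A B d S} → (toℚ 3 ℚ.+ η) * φ < A → (toℚ 3 ℚ.+ η) * φ < B →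
  A ℚ.+ B ≤ d ℚ.+ S → S ≤ (φ ℚ.+ φ) ℚ.+ (φ ℚ.+ φ) → (1ℚ ℚ.+ η) * (toℚ 2 * φ) < d
[1+η]*[2*φ]<d φ η {A} {B} {d} {S} X<A X<B A+B≤d+S S≤4φ = +-cancelʳ-< _ d F (begin-strict
  (1ℚ ℚ.+ η) * (toℚ 2 * φ) ℚ.+ F ≡⟨ identity φ η ⟩
  X ℚ.+ X                            <⟨ ℚ.+-mono-< X<A X<B ⟩
  A ℚ.+ B                            ≤⟨ A+B≤d+S ⟩
  d ℚ.+ S                            ≤⟨ ℚ.+-monoʳ-≤ d S≤4φ ⟩
  d ℚ.+ F                            ∎)
  where
  open ℚ.≤-Reasoning
  F X : ℚ
  F = (φ ℚ.+ φ) ℚ.+ (φ ℚ.+ φ)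
  X = (toℚ 3 ℚ.+ η) * φ
  identity : ∀ φ η → (1ℚ ℚ.+ η) * (toℚ 2 * φ) ℚ.+ ((φ ℚ.+ φ) ℚ.+ (φ ℚ.+ φ))
                     ≡ (toℚ 3 ℚ.+ η) * φ ℚ.+ (toℚ 3 ℚ.+ η) * φ
  identity = solve 2 (λ φ η → (con 1ℚ :+ η) :* (con (toℚ 2) :* φ) :+ ((φ :+ φ) :+ (φ :+ φ))
                              := (con (toℚ 3) :+ η) :* φ :+ (con (toℚ 3) :+ η) :* φ) refl

[1+½η]*t≤[1+η]*t : ∀ {η t} → 0ℚ ≤ η → 0ℚ ≤ t → (1ℚ ℚ.+ ½ * η) * t ≤ (1ℚ ℚ.+ η) * t
[1+½η]*t≤[1+η]*t {η} {t} η≥0 t≥0 =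
  ℚ.*-monoʳ-≤-nonNeg t {{ℚ.nonNegative t≥0}} (ℚ.+-monoʳ-≤ 1ℚ ½η≤η)
  where
  ½η≤η : ½ * η ≤ η
  ½η≤η = subst (½ * η ≤_) (ℚ.*-identityˡ η)
           (ℚ.*-monoʳ-≤-nonNeg η {{ℚ.nonNegative η≥0}} ½≤1)
    where
    ½≤1 : ½ ≤ 1ℚ
    ½≤1 = ℚ.*≤* (ℤ.+≤+ (ℕ.s≤s ℕ.z≤n))

module Run (G : SimpleGraph n) (φ η : ℚ) (φ≥0 : 0ℚ ≤ φ) (η≥0 : 0ℚ ≤ η)
           (c : Clustering n) (c-opt : ObjAtMost G c φ)
           (e : Fin n → Fin n → Bool) (e-valid : ∀ u v → ValidAnswer G η (toℚ 2 * φ) u v (e u v))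
           (r : Fin n → Fin n → Bool) (r-valid : ∀ w u → ValidAnswer G (½ * η) (toℚ 2 * φ) w u (r w u))
           where

  open ClusterPhi G φ η e r

  sameCluster⇒nbrDist≤2φ : ∀ {x y} → c x ≡ c y → toℚ (nbrDist G x y) ≤ toℚ 2 * φ
  sameCluster⇒nbrDist≤2φ {x} {y} x~y = ℚ.≤-trans
    (toℚ-mono-≤ (nbrDist≤disagreement+disagreement G c x~y))
    (subst (_ ≤_) (p+p≡2*p φ) (toℚ-+-≤ (disagreement G c x) (disagreement G c y) (c-opt x) (c-opt y)))

  sameCluster⇒e : ∀ {x y} → c x ≡ c y → e x y ≡ true
  sameCluster⇒e {x} {y} x~y = proj₂ (e-valid x y) (sameCluster⇒nbrDist≤2φ x~y)

  sameCluster⇒r : ∀ {x y} → c x ≡ c y → r x y ≡ true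
  sameCluster⇒r {x} {y} x~y = proj₂ (r-valid x y) (sameCluster⇒nbrDist≤2φ x~y)

  ∈Vhigh⇒threshold<deg : ∀ {x} → x ∈ Vhigh → (toℚ 3 ℚ.+ η) * φ < toℚ (deg G x)
  ∈Vhigh⇒threshold<deg {x} x∈ =
    ℚ.≰⇒> (¬-from-not-does (toℚ (deg G x) ℚ.≤? (toℚ 3 ℚ.+ η) * φ) (∈-tabulate⁻ _ x∈))

  ∉Vhigh⇒∈Vlow : ∀ {x} → x ∉ Vhigh → x ∈ Vlow
  ∉Vhigh⇒∈Vlow = ∉-tabulate-not _

  far-from-foreign-high : ∀ {x a b} → c x ≡ c a → a ∈ Vhigh → b ∈ Vhigh → c a ≢ c b →
    (1ℚ ℚ.+ η) * (toℚ 2 * φ) < toℚ (nbrDist G x b)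
  far-from-foreign-high {x} {a} {b} x~a a∈ b∈ a≁b =
    [1+η]*[2*φ]<d φ η (∈Vhigh⇒threshold<deg a∈) (∈Vhigh⇒threshold<deg b∈) degs≤ disagreements≤
    where
    ρ : Fin n → ℕ
    ρ = disagreement G c
    degs≤ : toℚ (deg G a) ℚ.+ toℚ (deg G b) ≤ toℚ (nbrDist G x b) ℚ.+ toℚ ((ρ x + ρ b) + (ρ a + ρ b))
    degs≤ = subst₂ _≤_ (toℚ-homo-+ (deg G a) (deg G b)) (toℚ-homo-+ (nbrDist G x b) ((ρ x + ρ b) + (ρ a + ρ b)))
              (toℚ-mono-≤ {deg G a + deg G b} {nbrDist G x b + ((ρ x + ρ b) + (ρ a + ρ b))} (deg+deg≤nbrDist+disagreements G c x~a a≁b))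
    disagreements≤ : toℚ ((ρ x + ρ b) + (ρ a + ρ b)) ≤ (φ ℚ.+ φ) ℚ.+ (φ ℚ.+ φ)
    disagreements≤ = toℚ-+-≤ (ρ x + ρ b) (ρ a + ρ b)
      (toℚ-+-≤ (ρ x) (ρ b) (c-opt x) (c-opt b)) (toℚ-+-≤ (ρ a) (ρ b) (c-opt a) (c-opt b))

  e-high⇒sameCluster : ∀ {x y} → x ∈ Vhigh → y ∈ Vhigh → e x y ≡ true → c x ≡ c y
  e-high⇒sameCluster {x} {y} x∈ y∈ exy = decidable-stable (c x ℕ.≟ c y) λ x≁y →
    contradiction (trans (sym exy) (proj₁ (e-valid x y) (far-from-foreign-high refl x∈ y∈ x≁y))) λ ()

  foreign⇒¬r : ∀ {x a b} → c x ≡ c a → a ∈ Vhigh → b ∈ Vhigh → c a ≢ c b → r x b ≡ false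
  foreign⇒¬r {x} {a} {b} x~a a∈ b∈ a≁b = proj₁ (r-valid x b)
    (ℚ.≤-<-trans ([1+½η]*t≤[1+η]*t {η} {toℚ 2 * φ} η≥0 0≤2φ) (far-from-foreign-high x~a a∈ b∈ a≁b))
    where
    0≤2φ : 0ℚ ≤ toℚ 2 * φ
    0≤2φ = ℚ.*-monoˡ-≤-nonNeg (toℚ 2) φ≥0

  Reach⇒∈Vhigh : ∀ {v w} → Reach v w → w ∈ Vhigh
  Reach⇒∈Vhigh (here v∈)     = v∈
  Reach⇒∈Vhigh (step _ x∈ _) = x∈

  Reach⇒sameCluster : ∀ {v w} → Reach v w → c w ≡ c v
  Reach⇒sameCluster (here _)             = refl
  Reach⇒sameCluster (step v⇝w x∈ ewx) =
    trans (sym (e-high⇒sameCluster (Reach⇒∈Vhigh v⇝w) x∈ ewx)) (Reach⇒sameCluster v⇝w)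

  ∈component⇔ : ∀ {L u} → IsComponent L → u ∈ L → ∀ w → w ∈ L ⇔ (w ∈ Vhigh × c w ≡ c u)
  ∈component⇔ {L} {u} (v , _ , L≡Reach) u∈L w = mk⇔ to from
    where
    v⇝u : Reach v u
    v⇝u = Equivalence.to (L≡Reach u) u∈L
    to : w ∈ L → w ∈ Vhigh × c w ≡ c u
    to w∈L = Reach⇒∈Vhigh v⇝w , trans (Reach⇒sameCluster v⇝w) (sym (Reach⇒sameCluster v⇝u))
      where
      v⇝w : Reach v w
      v⇝w = Equivalence.to (L≡Reach w) w∈L
    from : w ∈ Vhigh × c w ≡ c u → w ∈ L
    from (w∈ , w~u) = Equivalence.from (L≡Reach w) (step v⇝u w∈ (sameCluster⇒e (sym w~u)))

  ∈Vstage : ∀ {k} (u : Fin k → Fin n) i {w} → w ∈ Vlow →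
    (∀ j → j Fin.< i → r w (u j) ≡ false) → w ∈ Vstage u i
  ∈Vstage {suc k} u zero    w∈ _ = w∈
  ∈Vstage {suc k} u (suc i) {w} w∈ rejected = x∈p∧x∉q⇒x∈p─q w∈V w∉R
    where
    w∈V : w ∈ Vstage (u ∘ Fin.inject₁) i
    w∈V = ∈Vstage (u ∘ Fin.inject₁) i w∈ λ j j<i → rejected (Fin.inject₁ j) (Finₚ.≤̄⇒inject₁< (ℕ.<⇒≤ j<i))
    w∉R : w ∉ Rset (Vstage (u ∘ Fin.inject₁) i) (u (Fin.inject₁ i))
    w∉R w∈R with () ← trans (sym (∈-tabulate⁻ _ (proj₁ (x∈p∩q⁻ _ _ w∈R))))
                            (rejected (Fin.inject₁ i) (Finₚ.≤̄⇒inject₁< Finₚ.≤-refl))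

  module _ {k} {L : Fin k → Subset n} (enum : IsComponentEnumeration k L)
           {u : Fin k → Fin n} (u∈L : ∀ i → u i ∈ L i) where

    ∈L⇔ : ∀ i w → w ∈ L i ⇔ (w ∈ Vhigh × c w ≡ c (u i))
    ∈L⇔ i = ∈component⇔ (proj₁ enum i) (u∈L i)

    u∈Vhigh : ∀ i → u i ∈ Vhigh
    u∈Vhigh i = proj₁ (Equivalence.to (∈L⇔ i (u i)) (u∈L i))

    centre-cluster-injective : ∀ {i j} → c (u i) ≡ c (u j) → i ≡ j
    centre-cluster-injective {i} {j} ui~uj = proj₂ (proj₂ enum) i j (⊆-antisym (Li⊆Lj ui~uj) (Li⊆Lj (sym ui~uj)))
      where
      Li⊆Lj : ∀ {i j} → c (u i) ≡ c (u j) → L i ⊆ L j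
      Li⊆Lj {i} {j} ui~uj {w} w∈Li with w∈ , w~ui ← Equivalence.to (∈L⇔ i w) w∈Li =
        Equivalence.from (∈L⇔ j w) (w∈ , trans w~ui ui~uj)

    lowClustermate∈R : ∀ i {x} → x ∉ Vhigh → x ∈ CNbr G (u i) → c x ≡ c (u i) → x ∈ R u i
    lowClustermate∈R i {x} x∉ x∈N x~u =
      x∈p∩q⁺ (∈-tabulate⁺ _ (sameCluster⇒r x~u) , x∈p∩q⁺ (∈Vstage u i (∉Vhigh⇒∈Vlow x∉) notTakenEarlier , x∈Nbr))
      where
      notTakenEarlier : ∀ j → j Fin.< i → r x (u j) ≡ false
      notTakenEarlier j j<i =
        foreign⇒¬r x~u (u∈Vhigh i) (u∈Vhigh j) (λ ui~uj → Finₚ.<⇒≢ j<i (sym (centre-cluster-injective ui~uj)))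
      x∈Nbr : x ∈ Nbr G (u i)
      x∈Nbr with x∈p∪q⁻ (Nbr G (u i)) ⁅ u i ⁆ x∈N
      ... | inj₁ x∈Nbr = x∈Nbr
      ... | inj₂ x∈⁅u⁆ = contradiction (subst (_∈ Vhigh) (sym (x∈⁅y⁆⇒x≡y (u i) x∈⁅u⁆)) (u∈Vhigh i)) x∉

    N∩C⊆Cout : ∀ i → CNbr G (u i) ∩ cluster c (u i) ⊆ Cout L u i
    N∩C⊆Cout i {x} x∈N∩C = place (x ∈? Vhigh)
      where
      x∈N : x ∈ CNbr G (u i)
      x∈N = proj₁ (x∈p∩q⁻ (CNbr G (u i)) (cluster c (u i)) x∈N∩C)
      x~u : c x ≡ c (u i)
      x~u = ∈cluster⁻ c (proj₂ (x∈p∩q⁻ (CNbr G (u i)) (cluster c (u i)) x∈N∩C))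
      place : Dec (x ∈ Vhigh) → x ∈ Cout L u i
      place (yes x∈) = x∈p∪q⁺ (inj₁ (Equivalence.from (∈L⇔ i x) (x∈ , x~u)))
      place (no  x∉) = x∈p∪q⁺ (inj₂ (lowClustermate∈R i x∉ x∈N x~u))

    Cout⊆N∪C : ∀ i → Cout L u i ⊆ CNbr G (u i) ∪ cluster c (u i)
    Cout⊆N∪C i {x} x∈Cout with x∈p∪q⁻ (L i) (R u i) x∈Cout
    ... | inj₁ x∈L = x∈p∪q⁺ (inj₂ (∈cluster⁺ c (proj₂ (Equivalence.to (∈L⇔ i x) x∈L))))
    ... | inj₂ x∈R = x∈p∪q⁺ (inj₁ (p⊆p∪q ⁅ u i ⁆ x∈Nbr))
      where
      x∈V∩Nbr : x ∈ Vstage u i ∩ Nbr G (u i)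
      x∈V∩Nbr = proj₂ (x∈p∩q⁻ (tabulate λ w → r w (u i)) (Vstage u i ∩ Nbr G (u i)) x∈R)
      x∈Nbr : x ∈ Nbr G (u i)
      x∈Nbr = proj₂ (x∈p∩q⁻ (Vstage u i) (Nbr G (u i)) x∈V∩Nbr)

    cluster-of-component : ∀ i d → L i ∩ Vhigh ≡ cluster c d ∩ Vhigh → cluster c d ≡ cluster c (u i)
    cluster-of-component i d L∩H≡C∩H = cluster-cong c (sym (∈cluster⁻ c ui∈C))
      where
      ui∈C : u i ∈ cluster c d
      ui∈C = proj₁ (x∈p∩q⁻ (cluster c d) Vhigh (subst (u i ∈_) L∩H≡C∩H (x∈p∩q⁺ (u∈L i , u∈Vhigh i))))

mainTheorem7 :
  ∀ {n : ℕ} (G : SimpleGraph n) (φ η : ℚ) →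
  0ℚ ≤ φ → 0ℚ ≤ η → η < 1ℚ →
  (Cstar : Clustering n) → ObjAtMost G Cstar φ →
  -- an execution: answers to the similarity queries
  (e : Fin n → Fin n → Bool) →
  (∀ u v → e u v ≡ e v u) →
  (∀ u v → ValidAnswer G η (toℚ 2 * φ) u v (e u v)) →
  (r : Fin n → Fin n → Bool) →
  (∀ w u → ValidAnswer G (½ * η) (toℚ 2 * φ) w u (r w u)) →
  -- the components L_i, in any order, and the chosen u_i ∈ L_i
  (k : ℕ) (L : Fin k → Subset n) →
  ClusterPhi.IsComponentEnumeration G φ η e r k L →
  (u : Fin k → Fin n) → (∀ i → u i ∈ L i) →
  ∀ (i : Fin k) →
    toℚ ∣ CNbr G (u i) Δ ClusterPhi.Cout G φ η e r L u i ∣ ≤ φ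
    × (∀ (c : Fin n) →
         L i ∩ ClusterPhi.Vhigh G φ η e r ≡ cluster Cstar c ∩ ClusterPhi.Vhigh G φ η e r →
         toℚ ∣ cluster Cstar c Δ ClusterPhi.Cout G φ η e r L u i ∣ ≤ φ)
mainTheorem7 G φ η φ≥0 η≥0 _ Cstar opt e _ e-valid r r-valid k L enum u u∈L i =
    within-ρ[uᵢ] (pΔs⊆pΔq N∩C⊆Cᵢ Cᵢ⊆N∪C)
  , λ d L∩H≡C∩H → subst (λ C → toℚ ∣ C Δ Cout L u i ∣ ≤ φ) (sym (cluster-of-component enum u∈L i d L∩H≡C∩H))
                        (within-ρ[uᵢ] (qΔs⊆pΔq N∩C⊆Cᵢ Cᵢ⊆N∪C))
  where
  open Run G φ η φ≥0 η≥0 Cstar opt e e-valid r r-valid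
  open ClusterPhi G φ η e r
  N∩C⊆Cᵢ : CNbr G (u i) ∩ cluster Cstar (u i) ⊆ Cout L u i
  N∩C⊆Cᵢ = N∩C⊆Cout enum u∈L i
  Cᵢ⊆N∪C : Cout L u i ⊆ CNbr G (u i) ∪ cluster Cstar (u i)
  Cᵢ⊆N∪C = Cout⊆N∪C enum u∈L i
  within-ρ[uᵢ] : ∀ {D} → D ⊆ CNbr G (u i) Δ cluster Cstar (u i) → toℚ ∣ D ∣ ≤ φ
  within-ρ[uᵢ] D⊆ = ℚ.≤-trans (toℚ-mono-≤ (p⊆q⇒∣p∣≤∣q∣ D⊆)) (opt (u i))
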